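{- Let $n\ge 3$ and $S_f=\{f,r,r^{n-1}\}\subseteq D_n$. Then (a) $\lambda_1(D_n,S_f)=\lfloor n/2\rfloor+1$ if $4\mid n$; $\lambda_1(D_n,S_f)=\lfloor n/2\rfloor$ if $2\mid n$ and $4\nmid n$; $\lambda_1(D_n,S_f)=\lfloor n/2\rfloor+1$ if $n$ is odd; (b) $\lambda_2(D_n,S_f)=\lfloor n/2\rfloor$ if $4\mid n$, and $\lambda_2(D_n,S_f)=\lfloor n/2\rfloor+1$ if $4\nmid n$.
   Context: The dihedral group $D_n$ is the group of order $2n$ with presentation $\langle r,f\mid r^n=f^2=1,\ rf=fr^{ -1}\rangle$. For a generating set $S$ of a finite group $G$ and $g\in G$, $l_S(g)$ is the minimal number of factors in an expression of $g$ as a product of elements of $S$ ($l_S(1)=0$). Define $\lambda_1(G,S)=\max_{g\in G,\,s\in S} l_S(gsg^{ -1})$ and $\lambda_2(G,S)=\max_{g\in G,\,s,s'\in S} l_S(gss'g^{ -1})$. $\lfloor x\rfloor$ is the greatest integer $\le x$. -}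

module Defs where

open import Data.Nat using (ℕ; zero; suc; _+_; _∸_; _≤_; NonZero)
open import Data.Nat.DivMod using (_mod_)
open import Data.Fin using (Fin; toℕ)
open import Data.Bool using (Bool; true; false; _xor_)
open import Data.Product using (_×_; _,_; Σ; ∃; ∃-syntax)
open import Data.List using (List; []; _∷_; length)
open import Data.List.Relation.Unary.All using (All)
open import Data.List.Membership.Propositional using (_∈_)
open import Relation.Binary.PropositionalEquality using (_≡_)

-- The dihedral group D_n of order 2n, concretely: the pair (k , b)
-- stands for r^k f^b  (k ∈ ℤ/n, b ∈ {0,1}).
D : ℕ → Set
D n = Fin n × Bool

module _ (n : ℕ) .{{_ : NonZero n}} where

  negF : Fin n → Fin n
  negF a = (n ∸ toℕ a) mod n

  -- (r^a f^b)(r^c f^d) = r^(a + (-1)^b c) f^(b xor d)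
  _·_ : D n → D n → D n
  (a , false) · (c , d) = ((toℕ a + toℕ c) mod n , d)
  (a , true)  · (c , d) = ((toℕ a + toℕ (negF c)) mod n , true xor d)

  e : D n
  e = (0 mod n , false)

  inv : D n → D n
  inv (a , false) = (negF a , false)
  inv (a , true)  = (a , true)

  rot : ℕ → D n
  rot k = (k mod n , false)

  fl : D n
  fl = (0 mod n , true)

  Sf : List (D n)
  Sf = fl ∷ rot 1 ∷ rot (n ∸ 1) ∷ []

  prod : List (D n) → D n
  prod []       = e
  prod (x ∷ w) = x · prod w

  HasLength : List (D n) → D n → ℕ → Set
  HasLength S g k =
    (Σ (List (D n)) λ w → All (_∈ S) w × length w ≡ k × prod w ≡ g)
    × (∀ (w : List (D n)) → All (_∈ S) w → prod w ≡ g → k ≤ length w)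

  IsLambda1 : List (D n) → ℕ → Set
  IsLambda1 S m =
    (∀ (g s : D n) → s ∈ S → ∀ k → HasLength S ((g · s) · inv g) k → k ≤ m)
    × (∃[ g ] ∃[ s ] (s ∈ S × HasLength S ((g · s) · inv g) m))

  IsLambda2 : List (D n) → ℕ → Set
  IsLambda2 S m =
    (∀ (g s s' : D n) → s ∈ S → s' ∈ S → ∀ k →
       HasLength S (((g · s) · s') · inv g) k → k ≤ m)
    × (∃[ g ] ∃[ s ] ∃[ s' ] (s ∈ S × s' ∈ S ×
       HasLength S (((g · s) · s') · inv g) m))

module Submission where

-- Write elements as r^a f^b with 0 ≤ a < n and let d(a) = min(a, n - a) be the cyclic
-- distance of a from 0.  The word length with respect to S_f is given by the formula
--   ℓ(r^a) = d(a),   ℓ(r^a f) = 1 + d(a):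
-- explicit words (powers of r or r⁻¹, preceded by f for reflections) show l ≤ ℓ, and since
-- left multiplication by a generator raises ℓ by at most one, ℓ(w) ≤ |w| for every word
-- w, so l = ℓ.  Consequently every element has length at most ⌊n/2⌋ + 1.
-- For even n = 2h, χ(r^a f^b) = a + b (mod 2) is a homomorphism D_n → ℤ/2 with value 1 on
-- all generators, so conjugates g s g⁻¹ have χ = 1 and conjugates g s s' g⁻¹ have χ = 0.
-- A reflection r^a f with χ equal to the parity of h cannot have a = h, so its length is
-- at most h; this sharpens the bound to ⌊n/2⌋ for λ₁ when n ≡ 2 (mod 4) and for λ₂ when
-- 4 ∣ n.  In all six cases the bound is attained by r^a f r^(-a) = r^(2a) f or by
-- r^a r f r^(-a) = r^(2a+1) f for a suitable a.

open import Defs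
open import Data.Nat using (ℕ; _+_; _≤_; NonZero)
open import Data.Nat.DivMod using (_/_)
open import Data.Nat.Divisibility using (_∣_)
open import Data.Product using (_×_)
open import Relation.Nullary using (¬_)

open import Data.Nat using (zero; suc; _∸_; _*_; _⊓_; _<_; z≤n; s≤s; z<s; parity; >-nonZero⁻¹)
open import Data.Nat.Properties
open import Data.Nat.DivMod
  using (_mod_; _%_; m%n<n; m≡m%n+[m/n]*n; m<n⇒m%n≡m; n%n≡0; [m+n]%n≡m%n; [m+kn]%n≡m%n;
         m*n%n≡0; %-distribˡ-+; m%n%n≡m%n; m*n/n≡m; +-distrib-/)
open import Data.Nat.Divisibility using (divides)
open import Data.Parity.Base as ℙ using (Parity; 0ℙ; 1ℙ)
open import Data.Parity.Properties as ℙ using (+-homo-+; *-homo-*)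
open import Algebra.Properties.CommutativeSemigroup ℙ.+-commutativeSemigroup using (interchange)
open import Data.Fin.Base using (Fin; toℕ)
open import Data.Fin.Properties using (toℕ-fromℕ<; toℕ-injective; toℕ<n)
open import Data.Bool.Base using (Bool; true; false; _xor_)
open import Data.Product using (Σ; ∃-syntax; _,_; proj₁; proj₂)
open import Data.Sum.Base using (_⊎_; inj₁; inj₂)
open import Data.List.Base using (List; []; _∷_; length; replicate)
open import Data.List.Properties using (length-replicate)
open import Data.List.Relation.Unary.All using (All; []; _∷_)
open import Data.List.Relation.Unary.All.Properties using (replicate⁺)
open import Data.List.Relation.Unary.Any using (here; there)
open import Data.List.Membership.Propositional using (_∈_)
open import Relation.Nullary using (yes; no; contradiction)
open import Relation.Binary.PropositionalEquality
  using (_≡_; _≢_; refl; sym; trans; cong; cong₂; subst; module ≡-Reasoning)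

dist : ℕ → ℕ → ℕ
dist n x = x ⊓ (n ∸ x)

dist≤half : ∀ n h x → n ≤ suc (h + h) → dist n x ≤ h
dist≤half n h x n≤2h+1 with x ≤? h
... | yes x≤h = ≤-trans (m⊓n≤m x (n ∸ x)) x≤h
... | no x≰h  = ≤-trans (m⊓n≤n x (n ∸ x))
                  (m≤n+o⇒m∸n≤o n x (≤-trans n≤2h+1 (+-monoˡ-≤ h (≰⇒> x≰h))))

dist<half : ∀ n h x → n ≡ h + h → x < n → x ≢ h → dist n x < h
dist<half n h x n≡2h x<n x≢h with x ≤? h
... | yes x≤h = ≤-<-trans (m⊓n≤m x (n ∸ x)) (≤∧≢⇒< x≤h x≢h)
... | no x≰h  = ≤-<-trans (m⊓n≤n x (n ∸ x)) (+-cancelʳ-< x (n ∸ x) h n∸x+x<h+x)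
  where
  n∸x+x<h+x : (n ∸ x) + x < h + x
  n∸x+x<h+x = subst (_< h + x) (sym (trans (m∸n+n≡m (<⇒≤ x<n)) n≡2h)) (+-monoʳ-< h (≰⇒> x≰h))

dist-sym : ∀ n x → x ≤ n → dist n (n ∸ x) ≡ dist n x
dist-sym n x x≤n = begin
  (n ∸ x) ⊓ (n ∸ (n ∸ x)) ≡⟨ cong ((n ∸ x) ⊓_) (m∸[m∸n]≡n x≤n) ⟩
  (n ∸ x) ⊓ x             ≡⟨ ⊓-comm (n ∸ x) x ⟩
  x ⊓ (n ∸ x)             ∎
  where open ≡-Reasoning

dist-below : ∀ n x → x + x ≤ n → dist n x ≡ x
dist-below n x 2x≤n = m≤n⇒m⊓n≡m (m+n≤o⇒m≤o∸n x 2x≤n)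

dist-above : ∀ n x → n ≤ x + x → dist n x ≡ n ∸ x
dist-above n x n≤2x = m≥n⇒m⊓n≡n (m≤n+o⇒m∸n≤o n x n≤2x)

dist-suc : ∀ n x → dist n (suc x) ≤ suc (dist n x)
dist-suc n x = ⊓-mono-≤ (≤-refl {suc x}) (≤-trans (∸-monoʳ-≤ n (n≤1+n x)) (n≤1+n (n ∸ x)))

dist-pred : ∀ n x → dist n x ≤ suc (dist n (suc x))
dist-pred n x = ⊓-mono-≤ (m≤n⇒m≤1+n (n≤1+n x)) (∸-step n x)
  where
  ∸-step : ∀ m y → m ∸ y ≤ suc (m ∸ suc y)
  ∸-step zero    zero    = z≤n
  ∸-step zero    (suc y) = z≤n
  ∸-step (suc m) zero    = ≤-refl
  ∸-step (suc m) (suc y) = ∸-step m y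

module _ {n : ℕ} .{{_ : NonZero n}} where

  n∸1<n : n ∸ 1 < n
  n∸1<n = ∸-monoʳ-< z<s (>-nonZero⁻¹ n)

  suc[n∸1]≡n : suc (n ∸ 1) ≡ n
  suc[n∸1]≡n = m+[n∸m]≡n (>-nonZero⁻¹ n)

  dist-suc-% : ∀ x → x < n → dist n (suc x % n) ≤ suc (dist n x)
  dist-suc-% x x<n with suc x ≟ n
  ... | yes x+1≡n = ≤-trans (≤-reflexive (trans (cong (λ z → dist n (z % n)) x+1≡n)
                                               (cong (dist n) (n%n≡0 n)))) z≤n
  ... | no x+1≢n  rewrite m<n⇒m%n≡m (≤∧≢⇒< x<n x+1≢n) = dist-suc n x

  dist-pred-% : ∀ x → x < n → dist n ((n ∸ 1 + x) % n) ≤ suc (dist n x)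
  dist-pred-% zero _ = begin
    dist n ((n ∸ 1 + 0) % n)  ≡⟨ cong (λ z → dist n (z % n)) (+-identityʳ (n ∸ 1)) ⟩
    dist n ((n ∸ 1) % n)      ≡⟨ cong (dist n) (m<n⇒m%n≡m n∸1<n) ⟩
    dist n (n ∸ 1)            ≤⟨ m⊓n≤n (n ∸ 1) (n ∸ (n ∸ 1)) ⟩
    n ∸ (n ∸ 1)               ≡⟨ m∸[m∸n]≡n (>-nonZero⁻¹ n) ⟩
    1                         ∎
    where open ≤-Reasoning
  dist-pred-% (suc x) x+1<n = subst (λ z → dist n z ≤ suc (dist n (suc x))) (sym residue) (dist-pred n x)
    where
    open ≡-Reasoning
    residue : (n ∸ 1 + suc x) % n ≡ x
    residue = begin
      (n ∸ 1 + suc x) % n    ≡⟨ cong (_% n) (+-suc (n ∸ 1) x) ⟩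
      (suc (n ∸ 1) + x) % n  ≡⟨ cong (λ z → (z + x) % n) suc[n∸1]≡n ⟩
      (n + x) % n            ≡⟨ cong (_% n) (+-comm n x) ⟩
      (x + n) % n            ≡⟨ [m+n]%n≡m%n x n ⟩
      x % n                  ≡⟨ m<n⇒m%n≡m (<-trans (n<1+n x) x+1<n) ⟩
      x                      ∎

  dist-%-below : ∀ x → x + x ≤ n → dist n (x % n) ≡ x
  dist-%-below x 2x≤n = trans (cong (dist n) (m<n⇒m%n≡m (x<n x 2x≤n))) (dist-below n x 2x≤n)
    where
    x<n : ∀ x → x + x ≤ n → x < n
    x<n zero    _    = >-nonZero⁻¹ n
    x<n (suc x) 2x≤n = <-≤-trans (s≤s (m≤n+m (suc x) x)) 2x≤n

  dist-%-above : ∀ x → x < n → n ≤ x + x → dist n (x % n) ≡ n ∸ x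
  dist-%-above x x<n n≤2x = trans (cong (dist n) (m<n⇒m%n≡m x<n)) (dist-above n x n≤2x)

parity-double : ∀ h → parity (h + h) ≡ 0ℙ
parity-double h = trans (+-homo-+ h h) (ℙ.p+p≡0ℙ (parity h))

parity-double-suc : ∀ h → parity (suc (h + h)) ≡ 1ℙ
parity-double-suc h = trans (+-homo-+ 1 (h + h)) (cong (1ℙ ℙ.+_) (parity-double h))

parity-% : ∀ m n .{{_ : NonZero n}} → parity n ≡ 0ℙ → parity (m % n) ≡ parity m
parity-% m n even = begin
  parity (m % n)                                  ≡⟨ ℙ.+-identityʳ (parity (m % n)) ⟨
  parity (m % n) ℙ.+ 0ℙ                           ≡⟨ cong (parity (m % n) ℙ.+_) multiple-of-n ⟨
  parity (m % n) ℙ.+ parity (m / n * n)           ≡⟨ +-homo-+ (m % n) (m / n * n) ⟨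
  parity (m % n + m / n * n)                      ≡⟨ cong parity (m≡m%n+[m/n]*n m n) ⟨
  parity m                                        ∎
  where
  open ≡-Reasoning
  multiple-of-n : parity (m / n * n) ≡ 0ℙ
  multiple-of-n = trans (*-homo-* (m / n) n) (trans (cong (parity (m / n) ℙ.*_) even) (ℙ.*-zeroʳ _))

parity-∸ : ∀ n x → parity n ≡ 0ℙ → x ≤ n → parity (n ∸ x) ≡ parity x
parity-∸ n x even x≤n = ℙ.+-cancelʳ-≡ (parity x) _ _ (begin
  parity (n ∸ x) ℙ.+ parity x  ≡⟨ +-homo-+ (n ∸ x) x ⟨
  parity (n ∸ x + x)           ≡⟨ cong parity (m∸n+n≡m x≤n) ⟩
  parity n                     ≡⟨ even ⟩
  0ℙ                           ≡⟨ ℙ.p+p≡0ℙ (parity x) ⟨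
  parity x ℙ.+ parity x        ∎)
  where open ≡-Reasoning

conjugate-cancel : ∀ p q → (p ℙ.+ q) ℙ.+ p ≡ q
conjugate-cancel 0ℙ 0ℙ = refl
conjugate-cancel 0ℙ 1ℙ = refl
conjugate-cancel 1ℙ 0ℙ = refl
conjugate-cancel 1ℙ 1ℙ = refl

flip-≢ : ∀ p → p ℙ.+ 1ℙ ≢ p
flip-≢ 0ℙ ()
flip-≢ 1ℙ ()

halve : ∀ m → ∃[ q ] (q + q ≡ m ⊎ suc (q + q) ≡ m)
halve zero = 0 , inj₁ refl
halve (suc m) with halve m
... | q , inj₁ 2q≡m   = q , inj₂ (cong suc 2q≡m)
... | q , inj₂ 2q+1≡m = suc q , inj₁ (trans (cong suc (+-suc q q)) (cong suc 2q+1≡m))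

module Dihedral (n : ℕ) .{{_ : NonZero n}} (2≤n : 2 ≤ n) where

  infixl 7 _∙_
  _∙_ : D n → D n → D n
  _∙_ = _·_ n

  0<n : 0 < n
  0<n = >-nonZero⁻¹ n

  f∈ : fl n ∈ Sf n
  f∈ = here refl

  r∈ : rot n 1 ∈ Sf n
  r∈ = there (here refl)

  r⁻¹∈ : rot n (n ∸ 1) ∈ Sf n
  r⁻¹∈ = there (there (here refl))

  toℕ-mod : ∀ m → toℕ (m mod n) ≡ m % n
  toℕ-mod m = toℕ-fromℕ< (m%n<n m n)

  toℕ-mod-< : ∀ {m} → m < n → toℕ (m mod n) ≡ m
  toℕ-mod-< m<n = trans (toℕ-mod _) (m<n⇒m%n≡m m<n)

  negF-zero : ∀ a → toℕ a ≡ 0 → toℕ (negF n a) ≡ 0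
  negF-zero a a≡0 = trans (toℕ-mod _) (trans (cong (λ z → (n ∸ z) % n) a≡0) (n%n≡0 n))

  negF-nonzero : ∀ a → toℕ a ≢ 0 → toℕ (negF n a) ≡ n ∸ toℕ a
  negF-nonzero a a≢0 = toℕ-mod-< (∸-monoʳ-< (n≢0⇒n>0 a≢0) (<⇒≤ (toℕ<n a)))

  negF-involutive : ∀ a → negF n (negF n a) ≡ a
  negF-involutive a with toℕ a ≟ 0
  ... | yes a≡0 = toℕ-injective (trans (negF-zero _ (negF-zero a a≡0)) (sym a≡0))
  ... | no a≢0  = toℕ-injective (begin
    toℕ (negF n (negF n a))    ≡⟨ toℕ-mod _ ⟩
    (n ∸ toℕ (negF n a)) % n   ≡⟨ cong (λ z → (n ∸ z) % n) (negF-nonzero a a≢0) ⟩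
    (n ∸ (n ∸ toℕ a)) % n      ≡⟨ cong (_% n) (m∸[m∸n]≡n (<⇒≤ (toℕ<n a))) ⟩
    toℕ a % n                  ≡⟨ m<n⇒m%n≡m (toℕ<n a) ⟩
    toℕ a                      ∎)
    where open ≡-Reasoning

  dist-negF : ∀ a → dist n (toℕ (negF n a)) ≡ dist n (toℕ a)
  dist-negF a with toℕ a ≟ 0
  ... | yes a≡0 = cong (dist n) (trans (negF-zero a a≡0) (sym a≡0))
  ... | no a≢0  = trans (cong (dist n) (negF-nonzero a a≢0)) (dist-sym n (toℕ a) (<⇒≤ (toℕ<n a)))

  ℓ : D n → ℕ
  ℓ (a , false) = dist n (toℕ a)
  ℓ (a , true)  = suc (dist n (toℕ a))

  ℓ-after-f : ∀ x → ℓ (fl n ∙ x) ≤ suc (ℓ x)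
  ℓ-after-f (a , b) = by-bit b (trans (cong (dist n) index≡) (dist-negF a))
    where
    index≡ : toℕ ((toℕ (0 mod n) + toℕ (negF n a)) mod n) ≡ toℕ (negF n a)
    index≡ = trans (toℕ-mod _) (trans (cong (λ z → (z + toℕ (negF n a)) % n) (toℕ-mod-< 0<n))
                                      (m<n⇒m%n≡m (toℕ<n (negF n a))))
    by-bit : ∀ b {c} → dist n (toℕ c) ≡ dist n (toℕ a) → ℓ (c , true xor b) ≤ suc (ℓ (a , b))
    by-bit false eq = s≤s (≤-reflexive eq)
    by-bit true  eq = m≤n⇒m≤1+n (m≤n⇒m≤1+n (≤-reflexive eq))

  ℓ-after-rotation : ∀ k → k < n → (∀ x → x < n → dist n ((k + x) % n) ≤ suc (dist n x)) →
                     ∀ x → ℓ (rot n k ∙ x) ≤ suc (ℓ x)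
  ℓ-after-rotation k k<n shift (a , b) =
    by-bit b (subst (λ z → dist n z ≤ suc (dist n (toℕ a))) (sym index≡) (shift (toℕ a) (toℕ<n a)))
    where
    index≡ : toℕ ((toℕ (k mod n) + toℕ a) mod n) ≡ (k + toℕ a) % n
    index≡ = trans (toℕ-mod _) (cong (λ z → (z + toℕ a) % n) (toℕ-mod-< k<n))
    by-bit : ∀ b {c} → dist n (toℕ c) ≤ suc (dist n (toℕ a)) → ℓ (c , b) ≤ suc (ℓ (a , b))
    by-bit false le = le
    by-bit true  le = s≤s le

  ℓ-step : ∀ s x → s ∈ Sf n → ℓ (s ∙ x) ≤ suc (ℓ x)
  ℓ-step _ x (here refl)                 = ℓ-after-f x
  ℓ-step _ x (there (here refl))         = ℓ-after-rotation 1 2≤n dist-suc-% x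
  ℓ-step _ x (there (there (here refl))) = ℓ-after-rotation (n ∸ 1) n∸1<n dist-pred-% x

  ℓ-≤-length : ∀ w → All (_∈ Sf n) w → ℓ (prod n w) ≤ length w
  ℓ-≤-length []      []          = ≤-reflexive (cong (dist n) (toℕ-mod-< 0<n))
  ℓ-≤-length (s ∷ w) (s∈ ∷ w∈) = ≤-trans (ℓ-step s (prod n w) s∈) (s≤s (ℓ-≤-length w w∈))

  Word : D n → ℕ → Set
  Word x k = Σ (List (D n)) λ w → All (_∈ Sf n) w × length w ≡ k × prod n w ≡ x

  rot-+ : ∀ a b → rot n a ∙ rot n b ≡ rot n (a + b)
  rot-+ a b = cong (_, false) (toℕ-injective (begin
    toℕ ((toℕ (a mod n) + toℕ (b mod n)) mod n)  ≡⟨ toℕ-mod _ ⟩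
    (toℕ (a mod n) + toℕ (b mod n)) % n          ≡⟨ cong₂ (λ u v → (u + v) % n) (toℕ-mod a) (toℕ-mod b) ⟩
    (a % n + b % n) % n                          ≡⟨ %-distribˡ-+ a b n ⟨
    (a + b) % n                                  ≡⟨ toℕ-mod (a + b) ⟨
    toℕ ((a + b) mod n)                          ∎))
    where open ≡-Reasoning

  prod-replicate : ∀ k m → prod n (replicate k (rot n m)) ≡ rot n (k * m)
  prod-replicate zero    m = refl
  prod-replicate (suc k) m = trans (cong (rot n m ∙_) (prod-replicate k m)) (rot-+ m (k * m))

  -- (n - c) steps of r⁻¹ reach r^c.
  [n∸c]*[n∸1]≡c : ∀ c → c < n → ((n ∸ c) * (n ∸ 1)) % n ≡ c
  [n∸c]*[n∸1]≡c c c<n = begin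
    t % n                    ≡⟨ [m+n]%n≡m%n t n ⟨
    (t + n) % n              ≡⟨ cong (_% n) t+n≡c+[n∸c]*n ⟩
    (c + (n ∸ c) * n) % n    ≡⟨ [m+kn]%n≡m%n c (n ∸ c) n ⟩
    c % n                    ≡⟨ m<n⇒m%n≡m c<n ⟩
    c                        ∎
    where
    open ≡-Reasoning
    t : ℕ
    t = (n ∸ c) * (n ∸ 1)
    t+n≡c+[n∸c]*n : t + n ≡ c + (n ∸ c) * n
    t+n≡c+[n∸c]*n = begin
      t + n                      ≡⟨ cong (t +_) (m∸n+n≡m (<⇒≤ c<n)) ⟨
      t + ((n ∸ c) + c)          ≡⟨ +-assoc t (n ∸ c) c ⟨
      (t + (n ∸ c)) + c          ≡⟨ cong (_+ c) (+-comm t (n ∸ c)) ⟩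
      ((n ∸ c) + t) + c          ≡⟨ cong (_+ c) (*-suc (n ∸ c) (n ∸ 1)) ⟨
      (n ∸ c) * suc (n ∸ 1) + c  ≡⟨ cong (λ z → (n ∸ c) * z + c) suc[n∸1]≡n ⟩
      (n ∸ c) * n + c            ≡⟨ +-comm _ c ⟩
      c + (n ∸ c) * n            ∎

  rotation-word : ∀ c → Word (c , false) (dist n (toℕ c))
  rotation-word c with toℕ c ≤? n ∸ toℕ c
  ... | yes c≤n∸c = replicate (toℕ c) (rot n 1) , replicate⁺ (toℕ c) r∈ ,
    trans (length-replicate (toℕ c)) (sym (m≤n⇒m⊓n≡m c≤n∸c)) ,
    trans (prod-replicate (toℕ c) 1) (cong (_, false) (toℕ-injective
      (trans (toℕ-mod _) (trans (cong (_% n) (*-identityʳ (toℕ c))) (m<n⇒m%n≡m (toℕ<n c))))))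
  ... | no c≰n∸c  = replicate (n ∸ toℕ c) (rot n (n ∸ 1)) , replicate⁺ (n ∸ toℕ c) r⁻¹∈ ,
    trans (length-replicate (n ∸ toℕ c)) (sym (m≥n⇒m⊓n≡n (<⇒≤ (≰⇒> c≰n∸c)))) ,
    trans (prod-replicate (n ∸ toℕ c) (n ∸ 1)) (cong (_, false) (toℕ-injective
      (trans (toℕ-mod _) ([n∸c]*[n∸1]≡c (toℕ c) (toℕ<n c)))))

  -- r^c f = f r^(-c).
  reflection-word : ∀ c → Word (c , true) (suc (dist n (toℕ c)))
  reflection-word c =
    let (w , w∈ , len , prod≡) = rotation-word (negF n c)
    in fl n ∷ w , f∈ ∷ w∈ , cong suc (trans len (dist-negF c)) ,
       trans (cong (fl n ∙_) prod≡) (cong (_, true) f-negF)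
    where
    f-negF : (toℕ (0 mod n) + toℕ (negF n (negF n c))) mod n ≡ c
    f-negF = toℕ-injective (begin
      toℕ ((toℕ (0 mod n) + toℕ (negF n (negF n c))) mod n) ≡⟨ toℕ-mod _ ⟩
      (toℕ (0 mod n) + toℕ (negF n (negF n c))) % n         ≡⟨ cong₂ (λ u v → (u + toℕ v) % n) (toℕ-mod-< 0<n) (negF-involutive c) ⟩
      toℕ c % n                                             ≡⟨ m<n⇒m%n≡m (toℕ<n c) ⟩
      toℕ c                                                 ∎)
      where open ≡-Reasoning

  word : ∀ x → Word x (ℓ x)
  word (c , false) = rotation-word c
  word (c , true)  = reflection-word c

  ℓ-is-length : ∀ x → HasLength n (Sf n) x (ℓ x)
  ℓ-is-length x = word x , λ w w∈ prod≡ → subst (λ y → ℓ y ≤ length w) prod≡ (ℓ-≤-length w w∈)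

  length-≡-ℓ : ∀ {x k} → HasLength n (Sf n) x k → k ≡ ℓ x
  length-≡-ℓ ((w , w∈ , refl , refl) , minimal) =
    let (v , v∈ , len-v , prod-v) = word (prod n w)
    in ≤-antisym (subst (length w ≤_) len-v (minimal v v∈ prod-v)) (ℓ-≤-length w w∈)

  λ₁-from-ℓ : ∀ m → (∀ g s → s ∈ Sf n → ℓ ((g ∙ s) ∙ inv n g) ≤ m) →
              (∃[ g ] ∃[ s ] (s ∈ Sf n × ℓ ((g ∙ s) ∙ inv n g) ≡ m)) →
              IsLambda1 n (Sf n) m
  λ₁-from-ℓ m bound (g , s , s∈ , attained) =
    (λ g s s∈ k len → subst (_≤ m) (sym (length-≡-ℓ len)) (bound g s s∈)) ,
    g , s , s∈ , subst (HasLength n (Sf n) _) attained (ℓ-is-length _)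

  λ₂-from-ℓ : ∀ m → (∀ g s s' → s ∈ Sf n → s' ∈ Sf n → ℓ (((g ∙ s) ∙ s') ∙ inv n g) ≤ m) →
              (∃[ g ] ∃[ s ] ∃[ s' ] (s ∈ Sf n × s' ∈ Sf n × ℓ (((g ∙ s) ∙ s') ∙ inv n g) ≡ m)) →
              IsLambda2 n (Sf n) m
  λ₂-from-ℓ m bound (g , s , s' , s∈ , s'∈ , attained) =
    (λ g s s' s∈ s'∈ k len → subst (_≤ m) (sym (length-≡-ℓ len)) (bound g s s' s∈ s'∈)) ,
    g , s , s' , s∈ , s'∈ , subst (HasLength n (Sf n) _) attained (ℓ-is-length _)

  ℓ≤half+1 : ∀ h → n ≤ suc (h + h) → ∀ x → ℓ x ≤ suc h
  ℓ≤half+1 h n≤2h+1 (a , false) = m≤n⇒m≤1+n (dist≤half n h (toℕ a) n≤2h+1)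
  ℓ≤half+1 h n≤2h+1 (a , true)  = s≤s (dist≤half n h (toℕ a) n≤2h+1)

  module EvenOrder (n-even : parity n ≡ 0ℙ) where

    bit : Bool → Parity
    bit false = 0ℙ
    bit true  = 1ℙ

    bit-xor : ∀ b d → bit (b xor d) ≡ bit b ℙ.+ bit d
    bit-xor false d     = refl
    bit-xor true  false = refl
    bit-xor true  true  = refl

    χ : D n → Parity
    χ x = parity (toℕ (proj₁ x)) ℙ.+ bit (proj₂ x)

    parity-negF : ∀ a → parity (toℕ (negF n a)) ≡ parity (toℕ a)
    parity-negF a = trans (cong parity (toℕ-mod _))
      (trans (parity-% _ n n-even) (parity-∸ n (toℕ a) n-even (<⇒≤ (toℕ<n a))))

    -- The exponent of x · y is ±(exponent of y) plus the exponent of x, so parities add;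
    -- reflection bits add as well.
    parity-index-∙ : ∀ x y → parity (toℕ (proj₁ (x ∙ y))) ≡ parity (toℕ (proj₁ x)) ℙ.+ parity (toℕ (proj₁ y))
    parity-index-∙ (a , false) (c , d) =
      trans (cong parity (toℕ-mod _)) (trans (parity-% _ n n-even) (+-homo-+ (toℕ a) (toℕ c)))
    parity-index-∙ (a , true) (c , d) =
      trans (cong parity (toℕ-mod _)) (trans (parity-% _ n n-even)
        (trans (+-homo-+ (toℕ a) (toℕ (negF n c))) (cong (parity (toℕ a) ℙ.+_) (parity-negF c))))

    bit-∙ : ∀ x y → proj₂ (x ∙ y) ≡ proj₂ x xor proj₂ y
    bit-∙ (a , false) y = refl
    bit-∙ (a , true)  y = refl

    χ-∙ : ∀ x y → χ (x ∙ y) ≡ χ x ℙ.+ χ y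
    χ-∙ x y =
      trans (cong₂ ℙ._+_ (parity-index-∙ x y) (trans (cong bit (bit-∙ x y)) (bit-xor (proj₂ x) (proj₂ y))))
            (interchange (parity (toℕ (proj₁ x))) (parity (toℕ (proj₁ y))) (bit (proj₂ x)) (bit (proj₂ y)))

    χ-inv : ∀ x → χ (inv n x) ≡ χ x
    χ-inv (a , false) = cong (ℙ._+ 0ℙ) (parity-negF a)
    χ-inv (a , true)  = refl

    -- χ takes values in an abelian group of exponent 2, so it is invariant under conjugation.
    χ-conj : ∀ g s → χ ((g ∙ s) ∙ inv n g) ≡ χ s
    χ-conj g s = begin
      χ ((g ∙ s) ∙ inv n g)      ≡⟨ χ-∙ (g ∙ s) (inv n g) ⟩
      χ (g ∙ s) ℙ.+ χ (inv n g)  ≡⟨ cong₂ ℙ._+_ (χ-∙ g s) (χ-inv g) ⟩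
      (χ g ℙ.+ χ s) ℙ.+ χ g      ≡⟨ conjugate-cancel (χ g) (χ s) ⟩
      χ s                        ∎
      where open ≡-Reasoning

    χ-conj₂ : ∀ g s s' → χ (((g ∙ s) ∙ s') ∙ inv n g) ≡ χ s ℙ.+ χ s'
    χ-conj₂ g s s' = begin
      χ (((g ∙ s) ∙ s') ∙ inv n g)             ≡⟨ χ-∙ ((g ∙ s) ∙ s') (inv n g) ⟩
      χ ((g ∙ s) ∙ s') ℙ.+ χ (inv n g)         ≡⟨ cong₂ ℙ._+_ (trans (χ-∙ (g ∙ s) s') (cong (ℙ._+ χ s') (χ-∙ g s))) (χ-inv g) ⟩
      ((χ g ℙ.+ χ s) ℙ.+ χ s') ℙ.+ χ g         ≡⟨ cong (ℙ._+ χ g) (ℙ.+-assoc (χ g) (χ s) (χ s')) ⟩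
      (χ g ℙ.+ (χ s ℙ.+ χ s')) ℙ.+ χ g         ≡⟨ conjugate-cancel (χ g) (χ s ℙ.+ χ s') ⟩
      χ s ℙ.+ χ s'                             ∎
      where open ≡-Reasoning

    -- χ(f) = 0 + 1, χ(r) = 1 + 0 and χ(r⁻¹) = (n - 1) + 0 = 1 + 0.
    χ-generator : ∀ {s} → s ∈ Sf n → χ s ≡ 1ℙ
    χ-generator (here refl)                 = cong (λ z → parity z ℙ.+ 1ℙ) (toℕ-mod-< 0<n)
    χ-generator (there (here refl))         = cong (λ z → parity z ℙ.+ 0ℙ) (toℕ-mod-< 2≤n)
    χ-generator (there (there (here refl))) =
      cong (ℙ._+ 0ℙ) (trans (cong parity (toℕ-mod-< n∸1<n)) (parity-∸ n 1 n-even 0<n))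

    -- For n = 2h: an element with χ equal to the parity of h has length ≤ h, because a
    -- reflection r^a f of this kind has a + 1 ≢ h (mod 2), so a ≠ h and d(a) < h.
    ℓ≤half : ∀ h → n ≡ h + h → ∀ x → χ x ≡ parity h → ℓ x ≤ h
    ℓ≤half h n≡2h (a , false) _   = dist≤half n h (toℕ a) (≤-trans (≤-reflexive n≡2h) (n≤1+n _))
    ℓ≤half h n≡2h (a , true)  χ≡ = dist<half n h (toℕ a) n≡2h (toℕ<n a)
      (λ a≡h → flip-≢ (parity h) (subst (λ z → parity z ℙ.+ 1ℙ ≡ parity h) a≡h χ≡))

  -- The conjugates used as witnesses: r^b f r^(-a) = r^(b+a) f and r^a r f r^(-a) = r^(2a+1) f.
  ℓ-rot-f-rot⁻¹ : ∀ b a → ℓ ((rot n b ∙ fl n) ∙ inv n (rot n a)) ≡ suc (dist n ((b + a) % n))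
  ℓ-rot-f-rot⁻¹ b a = cong (λ z → suc (dist n z)) (begin
    toℕ ((toℕ x + toℕ (negF n (negF n (a mod n)))) mod n)  ≡⟨ toℕ-mod _ ⟩
    (toℕ x + toℕ (negF n (negF n (a mod n)))) % n          ≡⟨ cong₂ (λ u v → (u + toℕ v) % n) x≡b (negF-involutive (a mod n)) ⟩
    (b % n + toℕ (a mod n)) % n                            ≡⟨ cong (λ v → (b % n + v) % n) (toℕ-mod a) ⟩
    (b % n + a % n) % n                                    ≡⟨ %-distribˡ-+ b a n ⟨
    (b + a) % n                                            ∎)
    where
    open ≡-Reasoning
    x : Fin n
    x = proj₁ (rot n b ∙ fl n)
    x≡b : toℕ x ≡ b % n
    x≡b = begin
      toℕ x                                   ≡⟨ toℕ-mod _ ⟩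
      (toℕ (b mod n) + toℕ (0 mod n)) % n     ≡⟨ cong₂ (λ u v → (u + v) % n) (toℕ-mod b) (toℕ-mod-< 0<n) ⟩
      (b % n + 0) % n                         ≡⟨ cong (_% n) (+-identityʳ (b % n)) ⟩
      b % n % n                               ≡⟨ m%n%n≡m%n b n ⟩
      b % n                                   ∎

  ℓ-rot-rf-rot⁻¹ : ∀ a → ℓ (((rot n a ∙ rot n 1) ∙ fl n) ∙ inv n (rot n a)) ≡ suc (dist n (suc (a + a) % n))
  ℓ-rot-rf-rot⁻¹ a = trans (cong (λ y → ℓ ((y ∙ fl n) ∙ inv n (rot n a))) (rot-+ a 1))
    (trans (ℓ-rot-f-rot⁻¹ (a + 1) a) (cong (λ z → suc (dist n ((z + a) % n))) (+-comm a 1)))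

  dist-odd : ∀ h → n ≡ suc (h + h) → ∀ x → x ≡ h ⊎ x ≡ suc h → dist n (x % n) ≡ h
  dist-odd h n≡ x (inj₁ refl) = dist-%-below h (≤-trans (n≤1+n (h + h)) (≤-reflexive (sym n≡)))
  dist-odd h n≡ x (inj₂ refl) =
    trans (dist-%-above (suc h) (h+1<n h n≡) (≤-trans (≤-reflexive n≡) (s≤s (+-monoʳ-≤ h (n≤1+n h)))))
          (trans (cong (_∸ suc h) n≡) (m+n∸n≡m h h))
    where
    h+1<n : ∀ k → n ≡ suc (k + k) → suc k < n
    h+1<n zero    n≡1 = contradiction (subst (2 ≤_) n≡1 2≤n) λ { (s≤s ()) }
    h+1<n (suc k) n≡  = subst (suc (suc k) <_) (sym n≡) (s≤s (s≤s (m≤n+m (suc k) k)))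

  λ₁-four : ∀ q → n ≡ (q + q) + (q + q) → IsLambda1 n (Sf n) (suc (q + q))
  λ₁-four q n≡ = λ₁-from-ℓ _
    (λ g s _ → ℓ≤half+1 (q + q) (≤-trans (≤-reflexive n≡) (n≤1+n _)) ((g ∙ s) ∙ inv n g))
    (rot n q , fl n , f∈ , trans (ℓ-rot-f-rot⁻¹ q q) (cong suc (dist-%-below (q + q) (≤-reflexive (sym n≡)))))

  -- λ₁ for n = 4q + 2: conjugates of generators have χ = 1 = parity of 2q + 1, so length ≤ 2q + 1;
  -- r^q f r^(-q) = r^(2q) f attains it.
  λ₁-two : ∀ q → n ≡ suc (q + q) + suc (q + q) → IsLambda1 n (Sf n) (suc (q + q))
  λ₁-two q n≡ = λ₁-from-ℓ _ bound
    (rot n q , fl n , f∈ , trans (ℓ-rot-f-rot⁻¹ q q) (cong suc (dist-%-below (q + q) 4q≤n)))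
    where
    open EvenOrder (trans (cong parity n≡) (parity-double (suc (q + q))))
    bound : ∀ g s → s ∈ Sf n → ℓ ((g ∙ s) ∙ inv n g) ≤ suc (q + q)
    bound g s s∈ = ℓ≤half (suc (q + q)) n≡ ((g ∙ s) ∙ inv n g)
      (trans (χ-conj g s) (trans (χ-generator s∈) (sym (parity-double-suc q))))
    4q≤n : (q + q) + (q + q) ≤ n
    4q≤n = ≤-trans (+-mono-≤ (n≤1+n _) (n≤1+n _)) (≤-reflexive (sym n≡))

  λ₁-odd : ∀ h → n ≡ suc (h + h) → IsLambda1 n (Sf n) (suc h)
  λ₁-odd h n≡ = λ₁-from-ℓ _ (λ g s _ → ℓ≤half+1 h (≤-reflexive n≡) ((g ∙ s) ∙ inv n g)) witness
    where
    witness : ∃[ g ] ∃[ s ] (s ∈ Sf n × ℓ ((g ∙ s) ∙ inv n g) ≡ suc h)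
    witness with halve h
    ... | q , inj₁ 2q≡h   = rot n q , fl n , f∈ ,
      trans (ℓ-rot-f-rot⁻¹ q q) (cong suc (dist-odd h n≡ _ (inj₁ 2q≡h)))
    ... | q , inj₂ 2q+1≡h = rot n (suc q) , fl n , f∈ ,
      trans (ℓ-rot-f-rot⁻¹ (suc q) (suc q)) (cong suc (dist-odd h n≡ _ (inj₂ (cong suc (trans (+-suc q q) 2q+1≡h)))))

  -- λ₂ for n = 4q: conjugates of products of two generators have χ = 0 = parity of 2q,
  -- so length ≤ 2q; r^(q-1) r f r^(1-q) = r^(2q-1) f attains it.
  λ₂-four : ∀ q → n ≡ (q + q) + (q + q) → IsLambda2 n (Sf n) (q + q)
  λ₂-four zero    n≡0 = contradiction (subst (2 ≤_) n≡0 2≤n) λ ()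
  λ₂-four (suc p) n≡  = λ₂-from-ℓ _ bound (rot n p , rot n 1 , fl n , r∈ , f∈ ,
    trans (ℓ-rot-rf-rot⁻¹ p) (cong suc (trans (dist-%-below (suc (p + p)) 4p+2≤n) (sym (+-suc p p)))))
    where
    open EvenOrder (trans (cong parity n≡) (parity-double (suc p + suc p)))
    bound : ∀ g s s' → s ∈ Sf n → s' ∈ Sf n → ℓ (((g ∙ s) ∙ s') ∙ inv n g) ≤ suc p + suc p
    bound g s s' s∈ s'∈ = ℓ≤half (suc p + suc p) n≡ (((g ∙ s) ∙ s') ∙ inv n g) (trans (χ-conj₂ g s s')
      (trans (cong₂ ℙ._+_ (χ-generator s∈) (χ-generator s'∈)) (sym (parity-double (suc p)))))
    2p+1≤2q : suc (p + p) ≤ suc p + suc p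
    2p+1≤2q = s≤s (+-monoʳ-≤ p (n≤1+n p))
    4p+2≤n : suc (p + p) + suc (p + p) ≤ n
    4p+2≤n = ≤-trans (+-mono-≤ 2p+1≤2q 2p+1≤2q) (≤-reflexive (sym n≡))

  λ₂-two : ∀ q → n ≡ suc (q + q) + suc (q + q) → IsLambda2 n (Sf n) (suc (suc (q + q)))
  λ₂-two q n≡ = λ₂-from-ℓ _ (λ g s s' _ _ →
      ℓ≤half+1 (suc (q + q)) (≤-trans (≤-reflexive n≡) (n≤1+n _)) (((g ∙ s) ∙ s') ∙ inv n g))
    (rot n q , rot n 1 , fl n , r∈ , f∈ ,
     trans (ℓ-rot-rf-rot⁻¹ q) (cong suc (dist-%-below (suc (q + q)) (≤-reflexive (sym n≡)))))

  λ₂-odd : ∀ h → n ≡ suc (h + h) → IsLambda2 n (Sf n) (suc h)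
  λ₂-odd h n≡ = λ₂-from-ℓ _ (λ g s s' _ _ → ℓ≤half+1 h (≤-reflexive n≡) (((g ∙ s) ∙ s') ∙ inv n g)) witness
    where
    witness : ∃[ g ] ∃[ s ] ∃[ s' ] (s ∈ Sf n × s' ∈ Sf n × ℓ (((g ∙ s) ∙ s') ∙ inv n g) ≡ suc h)
    witness with halve h
    ... | q , inj₁ 2q≡h   = rot n q , rot n 1 , fl n , r∈ , f∈ ,
      trans (ℓ-rot-rf-rot⁻¹ q) (cong suc (dist-odd h n≡ _ (inj₂ (cong suc 2q≡h))))
    ... | q , inj₂ 2q+1≡h = rot n q , rot n 1 , fl n , r∈ , f∈ ,
      trans (ℓ-rot-rf-rot⁻¹ q) (cong suc (dist-odd h n≡ _ (inj₁ 2q+1≡h)))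

double : ∀ h → h * 2 ≡ h + h
double h = trans (*-comm h 2) (cong (h +_) (+-identityʳ h))

quadruple : ∀ q → q * 4 ≡ (q + q) + (q + q)
quadruple q = trans (sym (*-assoc q 2 2)) (trans (double (q * 2)) (cong₂ _+_ (double q) (double q)))

half-even : ∀ {n h} → n ≡ h + h → n / 2 ≡ h
half-even {n} {h} n≡ = trans (cong (_/ 2) (trans n≡ (sym (double h)))) (m*n/n≡m h 2)

half-odd : ∀ {n h} → n ≡ suc (h + h) → n / 2 ≡ h
half-odd {n} {h} n≡ = begin
  n / 2              ≡⟨ cong (_/ 2) (trans n≡ (cong suc (sym (double h)))) ⟩
  (1 + h * 2) / 2    ≡⟨ +-distrib-/ 1 (h * 2) (subst (λ z → 1 + z < 2) (sym (m*n%n≡0 h 2)) ≤-refl) ⟩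
  1 / 2 + h * 2 / 2  ≡⟨ cong (1 / 2 +_) (m*n/n≡m h 2) ⟩
  h                  ∎
  where open ≡-Reasoning

double-∣ : ∀ {n} h → h + h ≡ n → 2 ∣ n
double-∣ h 2h≡n = divides h (trans (sym 2h≡n) (sym (double h)))

shape-4∣ : ∀ {n} → 4 ∣ n → ∃[ q ] n ≡ (q + q) + (q + q)
shape-4∣ (divides q n≡q*4) = q , trans n≡q*4 (quadruple q)

shape-2∣-4∤ : ∀ {n} → 2 ∣ n → ¬ 4 ∣ n → ∃[ q ] n ≡ suc (q + q) + suc (q + q)
shape-2∣-4∤ (divides h n≡h*2) 4∤n with trans n≡h*2 (double h) | halve h
... | n≡2h | q , inj₁ 2q≡h   =
  contradiction (divides q (trans n≡2h (trans (sym (cong₂ _+_ 2q≡h 2q≡h)) (sym (quadruple q))))) 4∤n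
... | n≡2h | q , inj₂ 2q+1≡h = q , trans n≡2h (sym (cong₂ _+_ 2q+1≡h 2q+1≡h))

shape-2∤ : ∀ {n} → ¬ 2 ∣ n → ∃[ h ] n ≡ suc (h + h)
shape-2∤ {n} 2∤n with halve n
... | h , inj₁ 2h≡n   = contradiction (double-∣ h 2h≡n) 2∤n
... | h , inj₂ 2h+1≡n = h , sym 2h+1≡n

shape-4∤ : ∀ {n} → ¬ 4 ∣ n → (∃[ q ] n ≡ suc (q + q) + suc (q + q)) ⊎ (∃[ h ] n ≡ suc (h + h))
shape-4∤ {n} 4∤n with halve n
... | h , inj₁ 2h≡n   = inj₁ (shape-2∣-4∤ (double-∣ h 2h≡n) 4∤n)
... | h , inj₂ 2h+1≡n = inj₂ (h , sym 2h+1≡n)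

theorem9 : (n : ℕ) .{{_ : NonZero n}} → 3 ≤ n →
    ((4 ∣ n → IsLambda1 n (Sf n) (n / 2 + 1))
    × (2 ∣ n → ¬ (4 ∣ n) → IsLambda1 n (Sf n) (n / 2))
    × (¬ (2 ∣ n) → IsLambda1 n (Sf n) (n / 2 + 1)))
    × ((4 ∣ n → IsLambda2 n (Sf n) (n / 2))
    × (¬ (4 ∣ n) → IsLambda2 n (Sf n) (n / 2 + 1)))
theorem9 n n≥3 = (λ₁-when-4∣n , λ₁-when-2∣n-4∤n , λ₁-when-2∤n) , (λ₂-when-4∣n , λ₂-when-4∤n)
  where
  open Dihedral n (<⇒≤ n≥3)

  plus-one : ∀ {h} → n / 2 ≡ h → n / 2 + 1 ≡ suc h
  plus-one n/2≡h = trans (+-comm (n / 2) 1) (cong suc n/2≡h)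

  λ₁-when-4∣n : 4 ∣ n → IsLambda1 n (Sf n) (n / 2 + 1)
  λ₁-when-4∣n 4∣n = let (q , n≡) = shape-4∣ 4∣n in
    subst (IsLambda1 n (Sf n)) (sym (plus-one (half-even n≡))) (λ₁-four q n≡)

  λ₁-when-2∣n-4∤n : 2 ∣ n → ¬ (4 ∣ n) → IsLambda1 n (Sf n) (n / 2)
  λ₁-when-2∣n-4∤n 2∣n 4∤n = let (q , n≡) = shape-2∣-4∤ 2∣n 4∤n in
    subst (IsLambda1 n (Sf n)) (sym (half-even n≡)) (λ₁-two q n≡)

  λ₁-when-2∤n : ¬ (2 ∣ n) → IsLambda1 n (Sf n) (n / 2 + 1)
  λ₁-when-2∤n 2∤n = let (h , n≡) = shape-2∤ 2∤n in
    subst (IsLambda1 n (Sf n)) (sym (plus-one (half-odd n≡))) (λ₁-odd h n≡)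

  λ₂-when-4∣n : 4 ∣ n → IsLambda2 n (Sf n) (n / 2)
  λ₂-when-4∣n 4∣n = let (q , n≡) = shape-4∣ 4∣n in
    subst (IsLambda2 n (Sf n)) (sym (half-even n≡)) (λ₂-four q n≡)

  λ₂-when-4∤n : ¬ (4 ∣ n) → IsLambda2 n (Sf n) (n / 2 + 1)
  λ₂-when-4∤n 4∤n with shape-4∤ 4∤n
  ... | inj₁ (q , n≡) = subst (IsLambda2 n (Sf n)) (sym (plus-one (half-even n≡))) (λ₂-two q n≡)
  ... | inj₂ (h , n≡) = subst (IsLambda2 n (Sf n)) (sym (plus-one (half-odd n≡))) (λ₂-odd h n≡)
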